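{- For $n\geq1$ let $a_n=n!\sum_{i=1}^{n-1}\frac{1}{i!}$. For a finite sequence of integer pairs $(n_1,\alpha_1),\dots,(n_p,\alpha_p)$ with $p\geq1$, $n_i\geq2$ and $\alpha_i\geq1$, define recursively $$f\big((n_1,\alpha_1),\dots,(n_p,\alpha_p)\big)=\begin{cases}\alpha_1a_{n_1}&\text{if }p=1,\\ \alpha_1\big[a_{n_1}+n_1!\,f\big((n_2,\alpha_2),\dots,(n_p,\alpha_p)\big)\big]&\text{otherwise.}\end{cases}$$ Then for all integers $n\geq2$ and $\alpha\geq2$, $$f\big((n,\alpha),(n,\alpha-1),\dots,(n,1)\big)<f\big((\alpha,1),\underbrace{(n,1),\dots,(n,1)}_{\alpha\text{ times}}\big).$$ -}

module Defs where

open import Data.Nat using (ℕ; zero; suc; _!; _∸_)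
open import Data.Nat.Properties using (_!≢0)
open import Data.Integer using (+_)
open import Data.List using (List; []; _∷_; replicate)
open import Data.Product using (_×_; _,_)
open import Data.Rational using (ℚ; 0ℚ; _+_; _*_; _/_)

invFact : ℕ → ℚ
invFact i = _/_ (+ 1) (i !) {{i !≢0}}

fromℕ : ℕ → ℚ
fromℕ n = (+ n) / 1

sumInvFact : ℕ → ℚ
sumInvFact zero    = 0ℚ
sumInvFact (suc m) = sumInvFact m + invFact (suc m)

a : ℕ → ℚ
a n = fromℕ (n !) * sumInvFact (n ∸ 1)

-- f on a nonempty sequence of pairs (n₁,α₁) ∷ rest
f : ℕ × ℕ → List (ℕ × ℕ) → ℚ
f (n₁ , α₁) []         = fromℕ α₁ * a n₁
f (n₁ , α₁) (p ∷ rest) = fromℕ α₁ * (a n₁ + fromℕ (n₁ !) * f p rest)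

descTail : ℕ → ℕ → List (ℕ × ℕ)
descTail n zero          = []
descTail n (suc zero)    = []
descTail n (suc (suc k)) = (n , suc k) ∷ descTail n (suc k)

-- Write D_k = f((n,k+1),(n,k),…,(n,1)) and R_k = f((n,1),…,(n,1)) with k+1 entries. Both satisfy
-- the recursion X ↦ α(a_n + n! X) with α = k+1 resp. α = 1, so by induction D_k ≤ (k+1)! R_k.
-- The right-hand side of the theorem equals a_α + α! R_{α-1}, and a_α > 0 for α ≥ 2.
module Submission where

open import Defs
open import Data.Nat using (ℕ; _≥_; zero; suc; _!; s≤s; z≤n)
import Data.Nat as ℕ
import Data.Nat.Properties as ℕ
import Data.Nat.Coprimality as Coprime
open import Data.Integer using (+_; +≤+)
import Data.Integer as ℤ
import Data.Integer.Properties as ℤ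
open import Data.List using (replicate)
open import Data.Product using (_,_)
open import Data.Rational using (ℚ; mkℚ; _/_; _<_; _≤_; _+_; _*_; 0ℚ; 1ℚ; NonNegative; Positive; *≤*; positive; nonNegative)
open import Data.Rational.Properties
open import Data.Rational.Solver using (module +-*-Solver)
open import Relation.Binary.PropositionalEquality

fromℕ≡mkℚ : ∀ n → fromℕ n ≡ mkℚ (+ n) 0 (Coprime.sym (Coprime.1-coprimeTo n))
fromℕ≡mkℚ n = normalize-coprime (Coprime.sym (Coprime.1-coprimeTo n))

fromℕ-* : ∀ m n → fromℕ (m ℕ.* n) ≡ fromℕ m * fromℕ n
fromℕ-* m n rewrite fromℕ≡mkℚ m | fromℕ≡mkℚ n = cong (_/ 1) (ℤ.pos-* m n)

fromℕ-mono-≤ : ∀ {m n} → m ℕ.≤ n → fromℕ m ≤ fromℕ n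
fromℕ-mono-≤ {m} {n} m≤n rewrite fromℕ≡mkℚ m | fromℕ≡mkℚ n =
  *≤* (subst₂ ℤ._≤_ (sym (ℤ.*-identityʳ (+ m))) (sym (ℤ.*-identityʳ (+ n))) (+≤+ m≤n))

fromℕ-nonNeg : ∀ n → NonNegative (fromℕ n)
fromℕ-nonNeg n = nonNegative (fromℕ-mono-≤ {0} {n} z≤n)

1≤fromℕ-! : ∀ n → 1ℚ ≤ fromℕ (n !)
1≤fromℕ-! n = fromℕ-mono-≤ (ℕ.1≤n! n)

invFact-pos : ∀ i → Positive (invFact i)
invFact-pos i = normalize-pos 1 (i !) {{i ℕ.!≢0}}

sumInvFact-nonNeg : ∀ m → NonNegative (sumInvFact m)
sumInvFact-nonNeg zero    = _
sumInvFact-nonNeg (suc m) =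
  nonNeg+nonNeg⇒nonNeg (sumInvFact m) {{sumInvFact-nonNeg m}}
    (invFact (suc m)) {{pos⇒nonNeg (invFact (suc m)) {{invFact-pos (suc m)}}}}

sumInvFact-pos : ∀ m → Positive (sumInvFact (suc m))
sumInvFact-pos m =
  nonNeg+pos⇒pos (sumInvFact m) {{sumInvFact-nonNeg m}} (invFact (suc m)) {{invFact-pos (suc m)}}

a-nonNeg : ∀ n → NonNegative (a n)
a-nonNeg n =
  nonNeg*nonNeg⇒nonNeg (fromℕ (n !)) {{fromℕ-nonNeg (n !)}}
    (sumInvFact (n ℕ.∸ 1)) {{sumInvFact-nonNeg (n ℕ.∸ 1)}}

a-pos : ∀ n → n ≥ 2 → Positive (a n)
a-pos (suc zero) (s≤s ())
a-pos (suc (suc k)) _ =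
  pos*pos⇒pos (fromℕ (suc (suc k) !)) {{n!-pos}} (sumInvFact (suc k)) {{sumInvFact-pos k}}
  where
  n!-pos : Positive (fromℕ (suc (suc k) !))
  n!-pos = positive (<-≤-trans (positive⁻¹ 1ℚ) (1≤fromℕ-! (suc (suc k))))

affine-mono-scaled-≤ : ∀ {x c A N G H} → NonNegative x → NonNegative A → NonNegative N →
                       1ℚ ≤ c → G ≤ c * H → x * (A + N * G) ≤ (x * c) * (A + N * H)
affine-mono-scaled-≤ {x} {c} {A} {N} {G} {H} x≥0 A≥0 N≥0 1≤c G≤cH = begin
  x * (A + N * G)                  ≤⟨ *-monoˡ-≤-nonNeg x {{x≥0}} (+-monoʳ-≤ A (*-monoˡ-≤-nonNeg N {{N≥0}} G≤cH)) ⟩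
  x * (A + N * (c * H))            ≡⟨ regroup x c A N H ⟩
  x * A + (x * c) * (N * H)        ≤⟨ +-monoˡ-≤ ((x * c) * (N * H)) (*-monoʳ-≤-nonNeg A {{A≥0}} x≤xc) ⟩
  (x * c) * A + (x * c) * (N * H)  ≡⟨ sym (*-distribˡ-+ (x * c) A (N * H)) ⟩
  (x * c) * (A + N * H)            ∎
  where
  open ≤-Reasoning
  open +-*-Solver

  regroup : ∀ x c A N H → x * (A + N * (c * H)) ≡ x * A + (x * c) * (N * H)
  regroup = solve 5 (λ x c A N H → x :* (A :+ N :* (c :* H)) := x :* A :+ (x :* c) :* (N :* H)) refl

  x≤xc : x ≤ x * c
  x≤xc = subst (_≤ x * c) (*-identityʳ x) (*-monoˡ-≤-nonNeg x {{x≥0}} 1≤c)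

descending : ℕ → ℕ → ℚ
descending n k = f (n , suc k) (descTail n (suc k))

repeated : ℕ → ℕ → ℚ
repeated n k = f (n , 1) (replicate k (n , 1))

descending≤!*repeated : ∀ n k → descending n k ≤ fromℕ (suc k !) * repeated n k
descending≤!*repeated n zero    = ≤-reflexive (sym (*-identityˡ _))
descending≤!*repeated n (suc k) = begin
  fromℕ (suc (suc k)) * (a n + fromℕ (n !) * descending n k)
    -- fromℕ (suc (suc k)) normalises, so x and c cannot be recovered by unification
    ≤⟨ affine-mono-scaled-≤ {fromℕ (suc (suc k))} {fromℕ (suc k !)} {a n} {fromℕ (n !)}
         (fromℕ-nonNeg (suc (suc k))) (a-nonNeg n) (fromℕ-nonNeg (n !))
         (1≤fromℕ-! (suc k)) (descending≤!*repeated n k) ⟩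
  (fromℕ (suc (suc k)) * fromℕ (suc k !)) * (a n + fromℕ (n !) * repeated n k)
    ≡⟨ cong₂ _*_ (sym (fromℕ-* (suc (suc k)) (suc k !))) (sym (*-identityˡ _)) ⟩
  fromℕ (suc (suc k) !) * repeated n (suc k)
    ∎
  where open ≤-Reasoning

lemma7 : (n α : ℕ) → n ≥ 2 → α ≥ 2 →
    f (n , α) (descTail n α) < f (α , 1) (replicate α (n , 1))
lemma7 n (suc zero) _ (s≤s ())
lemma7 n α@(suc (suc k)) _ α≥2 = begin-strict
  descending n (suc k)  ≤⟨ descending≤!*repeated n (suc k) ⟩
  X                     ≡⟨ sym (+-identityˡ X) ⟩
  0ℚ + X                <⟨ +-monoˡ-< X (positive⁻¹ (a α) {{a-pos α α≥2}}) ⟩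
  a α + X               ≡⟨ sym (*-identityˡ _) ⟩
  f (α , 1) (replicate α (n , 1)) ∎
  where
  open ≤-Reasoning
  X : ℚ
  X = fromℕ (α !) * repeated n (suc k)
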